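{- For every integer $n\geq 1$ there is a compliform polynomial $e_n(x_2,\dots,x_n)$ such that, in the algebra $\mathrm{ETB}$, one has $$c_{n+1}=a_{n+1}+e_n(c_2,\dots,c_n).$$
   Context: A polynomial is called compliform if it has integer coefficients and has degree at most $1$ in each of its variables. Let $\mathrm{D}=\mathbb{Z}[1/2]$ and $\mathrm{L}=\mathrm{D}[a_1,a_2,\dots,b_1,b_2,\dots,c_1,c_2,\dots]$ be the polynomial ring in three sequences of indeterminates. Set $a_0=1$ and $a_x=0$ for $x\notin\mathbb{N}$. The algebra $\mathrm{ETB}$ is the quotient of $\mathrm{L}$ by the ideal generated by: $b_n-\sum_{k=0}^{n}a_ka_{n-k}$ ($n\geq1$); $2c_n-b_n-a_{n/2}$ ($n\geq 1$); $a_n^2-a_n$ ($n\geq1$); and $a_1-1$. (Hence $b_1=2$ and $c_1=1$ in $\mathrm{ETB}$.) Equivalently, in $\mathrm{ETB}$ one has $c_n=\sum_{0\leq k\leq n/2}a_ka_{n-k}$ with $a_0=a_1=1$. -}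

module Defs where

open import Level using (Level)
open import Algebra.Bundles using (CommutativeRing)
open import Data.Nat using (ℕ; zero; suc; _∸_; _≥_)
open import Data.Integer using (ℤ; +_; -[1+_])
open import Data.Bool using (Bool; true; false)
open import Data.Vec using (Vec; []; _∷_)
open import Data.Maybe using (Maybe; just; nothing)
import Data.Maybe as Maybe
open import Data.Product using (Σ; _×_)

-- A compliform polynomial in k variables (integer coefficients, degree ≤ 1
-- in each variable) is exactly a multilinear integer polynomial, i.e. an
-- integer coefficient for each monomial  Π_{i ∈ S} x_i , S ⊆ {1..k}.
-- A subset S is encoded by its characteristic vector in Vec Bool k.
Compliform : ℕ → Set
Compliform k = Vec Bool k → ℤ

half : ℕ → Maybe ℕ
half zero = just zero
half (suc zero) = nothing
half (suc (suc n)) = Maybe.map suc (half n)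

module Ops {ℓ₁ ℓ₂ : Level} (R : CommutativeRing ℓ₁ ℓ₂) where
  open CommutativeRing R hiding (zero)

  fromℕ : ℕ → Carrier
  fromℕ zero = 0#
  fromℕ (suc n) = 1# + fromℕ n

  fromℤ : ℤ → Carrier
  fromℤ (+ n) = fromℕ n
  fromℤ -[1+ n ] = - fromℕ (suc n)

  eval : {k : ℕ} → Compliform k → Vec Carrier k → Carrier
  eval {zero} e [] = fromℤ (e [])
  eval {suc k} e (x ∷ xs) =
    eval (λ v → e (false ∷ v)) xs + x * eval (λ v → e (true ∷ v)) xs

  sumTo : ℕ → (ℕ → Carrier) → Carrier
  sumTo zero f = f zero
  sumTo (suc n) f = sumTo n f + f (suc n)

  -- a_{n/2}, with the convention a_x = 0 for x ∉ ℕ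
  aHalf : (ℕ → Carrier) → ℕ → Carrier
  aHalf a n with half n
  ... | just m = a m
  ... | nothing = 0#

  -- 2 is invertible in R (so R is uniquely a ℤ[1/2]-algebra)
  TwoInvertible : Set (ℓ₁ Level.⊔ ℓ₂)
  TwoInvertible = Σ Carrier (λ h → h * (1# + 1#) ≈ 1#)

  record ETBRelations (a b c : ℕ → Carrier) : Set (ℓ₁ Level.⊔ ℓ₂) where
    field
      a₀ : a 0 ≈ 1#
      b-def : ∀ n → n ≥ 1 → b n ≈ sumTo n (λ k → a k * a (n ∸ k))
      c-def : ∀ n → n ≥ 1 → c n + c n ≈ b n + aHalf a n
      a-idem : ∀ n → n ≥ 1 → a n * a n ≈ a n
      a₁ : a 1 ≈ 1#

{-# OPTIONS --safe #-}
-- Since a_k² = a_k, pairing the terms k and n − k of b_n + a_{n/2} gives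
-- c_n = Σ_{0 ≤ k ≤ n/2} a_k a_{n−k} = a_n + P_n, with P_n a polynomial in
-- a_2, …, a_{n−1} that becomes multilinear once squares of the a_k are reduced.
-- The relations c_k = a_k + P_k are triangular and can be inverted inside
-- multilinear polynomials: with u, v, P_k in a_2, …, a_{k−1} one has
-- u + a_k v = (u − P_k v) + c_k v, and recursing on the lower variables rewrites
-- every multilinear polynomial in a_2, …, a_k as one in c_2, …, c_k.
-- Doing this to P_{n+1} gives e_n.
module Submission where

open import Defs
open import Level using (Level; 0ℓ)
open import Algebra.Bundles using (CommutativeRing)
open import Data.Bool using (false; true)
open import Data.Fin using (toℕ)
open import Data.Integer using (_⊖_)
open import Data.Integer.Properties using ([1+m]⊖[1+n]≡m⊖n)
open import Data.Nat using (ℕ; zero; suc; _∸_; ⌊_/2⌋; _≤_; _<_; s≤s; z≤n; _≟_)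
import Data.Nat as ℕ
open import Data.Nat.Properties
  using (≤∧≢⇒<; ≤-pred; ≤-refl; ≤-trans; m≤n⇒m≤1+n; n∸n≡0; +-∸-assoc; +-suc; m+n∸n≡m; m∸[m∸n]≡n; m∸n≤m; ⌊n/2⌋≤n)
open import Data.Maybe using (just; nothing)
open import Data.Product using (Σ; _×_; _,_)
open import Data.Vec using (Vec; []; _∷_; tabulate)
open import Relation.Nullary using (yes; no)
open import Relation.Binary.PropositionalEquality using (_≡_)
import Relation.Binary.PropositionalEquality as ≡

-- (p , q) : Multilinear 0 stands for the integer p − q, and
-- (u , v) : Multilinear (suc m) for u + xₘ v, with u, v in x₀, …, xₘ₋₁.
Multilinear : ℕ → Set
Multilinear zero    = ℕ × ℕ
Multilinear (suc m) = Multilinear m × Multilinear m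

0ᴹ : (m : ℕ) → Multilinear m
0ᴹ zero    = 0 , 0
0ᴹ (suc m) = 0ᴹ m , 0ᴹ m

1ᴹ : (m : ℕ) → Multilinear m
1ᴹ zero    = 1 , 0
1ᴹ (suc m) = 1ᴹ m , 0ᴹ m

infixl 6 _+ᴹ_
infixl 7 _*ᴹ_
infix  8 -ᴹ_

_+ᴹ_ : ∀ {m} → Multilinear m → Multilinear m → Multilinear m
_+ᴹ_ {zero}  (p , q) (p′ , q′) = p ℕ.+ p′ , q ℕ.+ q′
_+ᴹ_ {suc m} (u , v) (u′ , v′) = u +ᴹ u′ , v +ᴹ v′

-ᴹ_ : ∀ {m} → Multilinear m → Multilinear m
-ᴹ_ {zero}  (p , q) = q , p
-ᴹ_ {suc m} (u , v) = -ᴹ u , -ᴹ v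

-- xₘ² is reduced to xₘ, so this is the product only for idempotent variables.
_*ᴹ_ : ∀ {m} → Multilinear m → Multilinear m → Multilinear m
_*ᴹ_ {zero}  (p , q) (p′ , q′) = p ℕ.* p′ ℕ.+ q ℕ.* q′ , p ℕ.* q′ ℕ.+ q ℕ.* p′
_*ᴹ_ {suc m} (u , v) (u′ , v′) = u *ᴹ u′ , u *ᴹ v′ +ᴹ v *ᴹ u′ +ᴹ v *ᴹ v′

-- The variable xᵢ, and 0 when i ≥ m.
xᴹ : (m i : ℕ) → Multilinear m
xᴹ zero    i = 0ᴹ zero
xᴹ (suc m) i with i ≟ m
... | yes _ = 0ᴹ m , 1ᴹ m
... | no _  = xᴹ m i , 0ᴹ m

sumᴹ : ∀ {m} → ℕ → (ℕ → Multilinear m) → Multilinear m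
sumᴹ zero    f = f zero
sumᴹ (suc n) f = sumᴹ n f +ᴹ f (suc n)

-- Rewrites u + xₘ v as (u − pₘ v) + yₘ v all the way down, so the result is
-- read in the variables yₖ = xₖ + pₖ(x₀, …, xₖ₋₁).
substitute : ((k : ℕ) → Multilinear k) → ∀ {m} → Multilinear m → Multilinear m
substitute p {zero}  s       = s
substitute p {suc m} (u , v) = substitute p (u +ᴹ -ᴹ (p m *ᴹ v)) , substitute p v

-- snoc e₀ e₁ is e₀ + xₘ e₁ in the encoding of Compliform, whose eval splits off the first variable.
snoc : ∀ {m} → Compliform m → Compliform m → Compliform (suc m)
snoc {zero}  e₀ e₁ (false ∷ []) = e₀ []
snoc {zero}  e₀ e₁ (true ∷ [])  = e₁ []
snoc {suc m} e₀ e₁ (b ∷ w)      = snoc (λ w → e₀ (b ∷ w)) (λ w → e₁ (b ∷ w)) w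

toCompliform : ∀ {m} → Multilinear m → Compliform m
toCompliform {zero}  (p , q) [] = p ⊖ q
toCompliform {suc m} (u , v)    = snoc (toCompliform u) (toCompliform v)

module Evaluation {c ℓ : Level} (R : CommutativeRing c ℓ) where
  open CommutativeRing R
  open Ops R using (fromℕ; fromℤ; eval; sumTo)

  open import Algebra.Properties.Ring ring
    using (-0#≈0#; -‿+-comm; ⁻¹-anti-homo‿-; //-cong₂; -‿distribʳ-*; x[y-z]≈xy-xz; [y-z]x≈yx-zx)
  open import Algebra.Properties.Semiring.Mult semiring using (×-homo-+; ×1-homo-*)
    renaming (_×_ to _·_)
  open import Algebra.Solver.Ring.NaturalCoefficients.Default commutativeSemiring
    using (solve; _:+_; _:*_; _:=_)
  open import Relation.Binary.Reasoning.Setoid setoid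

  ⟦_⟧ : ∀ {m} → Multilinear m → (ℕ → Carrier) → Carrier
  ⟦_⟧ {zero}  (p , q) x = fromℕ p - fromℕ q
  ⟦_⟧ {suc m} (u , v) x = ⟦ u ⟧ x + x m * ⟦ v ⟧ x

  x-0≈x : ∀ x → x - 0# ≈ x
  x-0≈x x = trans (+-congˡ -0#≈0#) (+-identityʳ x)

  x+y*0≈x : ∀ x y → x + y * 0# ≈ x
  x+y*0≈x x y = trans (+-congˡ (zeroʳ y)) (+-identityʳ x)

  [w+x]-[y+z]≈[w-y]+[x-z] : ∀ w x y z → (w + x) - (y + z) ≈ (w - y) + (x - z)
  [w+x]-[y+z]≈[w-y]+[x-z] w x y z = begin
    (w + x) + - (y + z)     ≈⟨ +-congˡ (-‿+-comm y z) ⟨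
    (w + x) + (- y + - z)   ≈⟨ solve 4 (λ w x y z → (w :+ x) :+ (y :+ z) := (w :+ y) :+ (x :+ z)) refl w x (- y) (- z) ⟩
    (w + - y) + (x + - z)   ∎

  [w-x][y-z]≈[wy+xz]-[wz+xy] : ∀ w x y z → (w - x) * (y - z) ≈ (w * y + x * z) - (w * z + x * y)
  [w-x][y-z]≈[wy+xz]-[wz+xy] w x y z = begin
    (w - x) * (y - z)                ≈⟨ x[y-z]≈xy-xz (w - x) y z ⟩
    (w - x) * y - (w - x) * z        ≈⟨ //-cong₂ ([y-z]x≈yx-zx y w x) ([y-z]x≈yx-zx z w x) ⟩
    (w * y - x * y) - (w * z - x * z) ≈⟨ +-congˡ (⁻¹-anti-homo‿- (w * z) (x * z)) ⟩
    (w * y - x * y) + (x * z - w * z) ≈⟨ [w+x]-[y+z]≈[w-y]+[x-z] (w * y) (x * z) (x * y) (w * z) ⟨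
    (w * y + x * z) - (x * y + w * z) ≈⟨ +-congˡ (-‿cong (+-comm (x * y) (w * z))) ⟩
    (w * y + x * z) - (w * z + x * y) ∎

  fromℕ≈×1 : ∀ n → fromℕ n ≈ n · 1#
  fromℕ≈×1 zero    = refl
  fromℕ≈×1 (suc n) = +-congˡ (fromℕ≈×1 n)

  fromℕ-homo-+ : ∀ p q → fromℕ (p ℕ.+ q) ≈ fromℕ p + fromℕ q
  fromℕ-homo-+ p q = begin
    fromℕ (p ℕ.+ q)     ≈⟨ fromℕ≈×1 (p ℕ.+ q) ⟩
    (p ℕ.+ q) · 1#      ≈⟨ ×-homo-+ 1# p q ⟩
    p · 1# + q · 1#     ≈⟨ +-cong (fromℕ≈×1 p) (fromℕ≈×1 q) ⟨
    fromℕ p + fromℕ q   ∎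

  fromℕ-homo-* : ∀ p q → fromℕ (p ℕ.* q) ≈ fromℕ p * fromℕ q
  fromℕ-homo-* p q = begin
    fromℕ (p ℕ.* q)     ≈⟨ fromℕ≈×1 (p ℕ.* q) ⟩
    (p ℕ.* q) · 1#      ≈⟨ ×1-homo-* p q ⟩
    p · 1# * (q · 1#)   ≈⟨ *-cong (fromℕ≈×1 p) (fromℕ≈×1 q) ⟨
    fromℕ p * fromℕ q   ∎

  fromℤ-⊖ : ∀ p q → fromℤ (p ⊖ q) ≈ fromℕ p - fromℕ q
  fromℤ-⊖ p       zero    = sym (x-0≈x (fromℕ p))
  fromℤ-⊖ zero    (suc q) = sym (+-identityˡ _)
  fromℤ-⊖ (suc p) (suc q) rewrite [1+m]⊖[1+n]≡m⊖n p q = begin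
    fromℤ (p ⊖ q)                    ≈⟨ fromℤ-⊖ p q ⟩
    fromℕ p - fromℕ q                ≈⟨ +-identityˡ _ ⟨
    0# + (fromℕ p - fromℕ q)         ≈⟨ +-congʳ (-‿inverseʳ 1#) ⟨
    (1# - 1#) + (fromℕ p - fromℕ q)  ≈⟨ [w+x]-[y+z]≈[w-y]+[x-z] 1# (fromℕ p) 1# (fromℕ q) ⟨
    fromℕ (suc p) - fromℕ (suc q)    ∎

  0ᴹ-homo : ∀ m x → ⟦ 0ᴹ m ⟧ x ≈ 0#
  0ᴹ-homo zero    x = -‿inverseʳ 0#
  0ᴹ-homo (suc m) x = trans (+-cong (0ᴹ-homo m x) (*-congˡ (0ᴹ-homo m x))) (x+y*0≈x 0# (x m))

  1ᴹ-homo : ∀ m x → ⟦ 1ᴹ m ⟧ x ≈ 1#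
  1ᴹ-homo zero    x = trans (x-0≈x (1# + 0#)) (+-identityʳ 1#)
  1ᴹ-homo (suc m) x = trans (+-cong (1ᴹ-homo m x) (*-congˡ (0ᴹ-homo m x))) (x+y*0≈x 1# (x m))

  +ᴹ-homo : ∀ {m} (s t : Multilinear m) x → ⟦ s +ᴹ t ⟧ x ≈ ⟦ s ⟧ x + ⟦ t ⟧ x
  +ᴹ-homo {zero}  (p , q) (p′ , q′) x = begin
    fromℕ (p ℕ.+ p′) - fromℕ (q ℕ.+ q′)          ≈⟨ +-cong (fromℕ-homo-+ p p′) (-‿cong (fromℕ-homo-+ q q′)) ⟩
    (fromℕ p + fromℕ p′) - (fromℕ q + fromℕ q′)  ≈⟨ [w+x]-[y+z]≈[w-y]+[x-z] _ _ _ _ ⟩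
    (fromℕ p - fromℕ q) + (fromℕ p′ - fromℕ q′)  ∎
  +ᴹ-homo {suc m} (u , v) (u′ , v′) x = begin
    ⟦ u +ᴹ u′ ⟧ x + x m * ⟦ v +ᴹ v′ ⟧ x   ≈⟨ +-cong (+ᴹ-homo u u′ x) (*-congˡ (+ᴹ-homo v v′ x)) ⟩
    (U + U′) + x m * (V + V′)             ≈⟨ solve 5 (λ X U V U′ V′ → (U :+ U′) :+ X :* (V :+ V′) := (U :+ X :* V) :+ (U′ :+ X :* V′)) refl (x m) U V U′ V′ ⟩
    (U + x m * V) + (U′ + x m * V′)       ∎
    where
    U = ⟦ u ⟧ x; V = ⟦ v ⟧ x; U′ = ⟦ u′ ⟧ x; V′ = ⟦ v′ ⟧ x

  -ᴹ-homo : ∀ {m} (s : Multilinear m) x → ⟦ -ᴹ s ⟧ x ≈ - ⟦ s ⟧ x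
  -ᴹ-homo {zero}  (p , q) x = sym (⁻¹-anti-homo‿- (fromℕ p) (fromℕ q))
  -ᴹ-homo {suc m} (u , v) x = begin
    ⟦ -ᴹ u ⟧ x + x m * ⟦ -ᴹ v ⟧ x   ≈⟨ +-cong (-ᴹ-homo u x) (*-congˡ (-ᴹ-homo v x)) ⟩
    - ⟦ u ⟧ x + x m * - ⟦ v ⟧ x     ≈⟨ +-congˡ (-‿distribʳ-* (x m) (⟦ v ⟧ x)) ⟨
    - ⟦ u ⟧ x + - (x m * ⟦ v ⟧ x)   ≈⟨ -‿+-comm (⟦ u ⟧ x) (x m * ⟦ v ⟧ x) ⟩
    - (⟦ u ⟧ x + x m * ⟦ v ⟧ x)     ∎

  idempotent-split-*
    : ∀ {X} → X * X ≈ X → ∀ U V U′ V′ →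
      U * U′ + X * (U * V′ + V * U′ + V * V′) ≈ (U + X * V) * (U′ + X * V′)
  idempotent-split-* {X} X²≈X U V U′ V′ = begin
    U * U′ + X * (U * V′ + V * U′ + V * V′)
      ≈⟨ solve 5 (λ X U V U′ V′ → U :* U′ :+ X :* (U :* V′ :+ V :* U′ :+ V :* V′)
                                := U :* U′ :+ X :* (U :* V′ :+ V :* U′) :+ X :* (V :* V′)) refl X U V U′ V′ ⟩
    U * U′ + X * (U * V′ + V * U′) + X * (V * V′)
      ≈⟨ +-congˡ (*-congʳ X²≈X) ⟨
    U * U′ + X * (U * V′ + V * U′) + X * X * (V * V′)
      ≈⟨ solve 5 (λ X U V U′ V′ → U :* U′ :+ X :* (U :* V′ :+ V :* U′) :+ X :* X :* (V :* V′)
                                := (U :+ X :* V) :* (U′ :+ X :* V′)) refl X U V U′ V′ ⟩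
    (U + X * V) * (U′ + X * V′) ∎

  *ᴹ-homo : ∀ {m} x → (∀ i → x i * x i ≈ x i) →
            (s t : Multilinear m) → ⟦ s *ᴹ t ⟧ x ≈ ⟦ s ⟧ x * ⟦ t ⟧ x
  *ᴹ-homo {zero}  x idem (p , q) (p′ , q′) = begin
    fromℕ (p ℕ.* p′ ℕ.+ q ℕ.* q′) - fromℕ (p ℕ.* q′ ℕ.+ q ℕ.* p′)
      ≈⟨ +-cong (homo p p′ q q′) (-‿cong (homo p q′ q p′)) ⟩
    (fromℕ p * fromℕ p′ + fromℕ q * fromℕ q′) - (fromℕ p * fromℕ q′ + fromℕ q * fromℕ p′)
      ≈⟨ [w-x][y-z]≈[wy+xz]-[wz+xy] _ _ _ _ ⟨
    (fromℕ p - fromℕ q) * (fromℕ p′ - fromℕ q′) ∎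
    where
    homo : ∀ a b c d → fromℕ (a ℕ.* b ℕ.+ c ℕ.* d) ≈ fromℕ a * fromℕ b + fromℕ c * fromℕ d
    homo a b c d = trans (fromℕ-homo-+ (a ℕ.* b) (c ℕ.* d)) (+-cong (fromℕ-homo-* a b) (fromℕ-homo-* c d))
  *ᴹ-homo {suc m} x idem (u , v) (u′ , v′) = begin
    ⟦ u *ᴹ u′ ⟧ x + x m * ⟦ u *ᴹ v′ +ᴹ v *ᴹ u′ +ᴹ v *ᴹ v′ ⟧ x
      ≈⟨ +-cong (homo u u′) (*-congˡ (begin
           ⟦ u *ᴹ v′ +ᴹ v *ᴹ u′ +ᴹ v *ᴹ v′ ⟧ x
             ≈⟨ +ᴹ-homo (u *ᴹ v′ +ᴹ v *ᴹ u′) (v *ᴹ v′) x ⟩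
           ⟦ u *ᴹ v′ +ᴹ v *ᴹ u′ ⟧ x + ⟦ v *ᴹ v′ ⟧ x
             ≈⟨ +-cong (trans (+ᴹ-homo (u *ᴹ v′) (v *ᴹ u′) x) (+-cong (homo u v′) (homo v u′))) (homo v v′) ⟩
           U * V′ + V * U′ + V * V′ ∎)) ⟩
    U * U′ + x m * (U * V′ + V * U′ + V * V′)
      ≈⟨ idempotent-split-* (idem m) U V U′ V′ ⟩
    (U + x m * V) * (U′ + x m * V′) ∎
    where
    U = ⟦ u ⟧ x; V = ⟦ v ⟧ x; U′ = ⟦ u′ ⟧ x; V′ = ⟦ v′ ⟧ x
    homo : (s t : Multilinear m) → ⟦ s *ᴹ t ⟧ x ≈ ⟦ s ⟧ x * ⟦ t ⟧ x
    homo = *ᴹ-homo x idem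

  xᴹ-homo : ∀ {m i} x → i < m → ⟦ xᴹ m i ⟧ x ≈ x i
  xᴹ-homo {suc m} {i} x i<1+m with i ≟ m
  ... | yes ≡.refl = begin
    ⟦ 0ᴹ m ⟧ x + x m * ⟦ 1ᴹ m ⟧ x  ≈⟨ +-cong (0ᴹ-homo m x) (*-congˡ (1ᴹ-homo m x)) ⟩
    0# + x m * 1#                  ≈⟨ +-identityˡ _ ⟩
    x m * 1#                       ≈⟨ *-identityʳ (x m) ⟩
    x m                            ∎
  ... | no i≢m = begin
    ⟦ xᴹ m i ⟧ x + x m * ⟦ 0ᴹ m ⟧ x  ≈⟨ +-cong (xᴹ-homo x (≤∧≢⇒< (≤-pred i<1+m) i≢m)) (*-congˡ (0ᴹ-homo m x)) ⟩
    x i + x m * 0#                   ≈⟨ x+y*0≈x (x i) (x m) ⟩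
    x i                              ∎

  sumᴹ-homo : ∀ {m} n (f : ℕ → Multilinear m) x → ⟦ sumᴹ n f ⟧ x ≈ sumTo n (λ k → ⟦ f k ⟧ x)
  sumᴹ-homo zero    f x = refl
  sumᴹ-homo (suc n) f x = trans (+ᴹ-homo (sumᴹ n f) (f (suc n)) x) (+-congʳ (sumᴹ-homo n f x))

  [u-pv]+[x+p]v≈u+xv : ∀ u v x p → (u - p * v) + (x + p) * v ≈ u + x * v
  [u-pv]+[x+p]v≈u+xv u v x p = begin
    (u + - (p * v)) + (x + p) * v        ≈⟨ solve 5 (λ u v x p n → (u :+ n) :+ (x :+ p) :* v := (u :+ x :* v) :+ (p :* v :+ n)) refl u v x p (- (p * v)) ⟩
    (u + x * v) + (p * v + - (p * v))    ≈⟨ +-congˡ (-‿inverseʳ (p * v)) ⟩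
    (u + x * v) + 0#                     ≈⟨ +-identityʳ _ ⟩
    u + x * v                            ∎

  substitute-correct
    : (p : (k : ℕ) → Multilinear k) (x y : ℕ → Carrier) →
      (∀ i → x i * x i ≈ x i) → (∀ k → y k ≈ x k + ⟦ p k ⟧ x) →
      ∀ {m} (s : Multilinear m) → ⟦ substitute p s ⟧ y ≈ ⟦ s ⟧ x
  substitute-correct p x y idem y≈x+p {zero}  s       = refl
  substitute-correct p x y idem y≈x+p {suc m} (u , v) = begin
    ⟦ substitute p (u +ᴹ -ᴹ (p m *ᴹ v)) ⟧ y + y m * ⟦ substitute p v ⟧ y
      ≈⟨ +-cong (correct (u +ᴹ -ᴹ (p m *ᴹ v))) (*-cong (y≈x+p m) (correct v)) ⟩
    ⟦ u +ᴹ -ᴹ (p m *ᴹ v) ⟧ x + (x m + ⟦ p m ⟧ x) * ⟦ v ⟧ x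
      ≈⟨ +-congʳ (trans (+ᴹ-homo u (-ᴹ (p m *ᴹ v)) x)
                   (+-congˡ (trans (-ᴹ-homo (p m *ᴹ v) x) (-‿cong (*ᴹ-homo x idem (p m) v))))) ⟩
    (⟦ u ⟧ x - ⟦ p m ⟧ x * ⟦ v ⟧ x) + (x m + ⟦ p m ⟧ x) * ⟦ v ⟧ x
      ≈⟨ [u-pv]+[x+p]v≈u+xv (⟦ u ⟧ x) (⟦ v ⟧ x) (x m) (⟦ p m ⟧ x) ⟩
    ⟦ u ⟧ x + x m * ⟦ v ⟧ x ∎
    where
    correct : ∀ {m} (s : Multilinear m) → ⟦ substitute p s ⟧ y ≈ ⟦ s ⟧ x
    correct = substitute-correct p x y idem y≈x+p

  eval-snoc : ∀ {m} (y : ℕ → Carrier) (e₀ e₁ : Compliform m) →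
              eval (snoc e₀ e₁) (tabulate (λ i → y (toℕ i))) ≈
              eval e₀ (tabulate (λ i → y (toℕ i))) + y m * eval e₁ (tabulate (λ i → y (toℕ i)))
  eval-snoc {zero}  y e₀ e₁ = refl
  eval-snoc {suc m} y e₀ e₁ = begin
    eval (snoc e₀ᶠ e₁ᶠ) ys + y 0 * eval (snoc e₀ᵗ e₁ᵗ) ys
      ≈⟨ +-cong (eval-snoc y′ e₀ᶠ e₁ᶠ) (*-congˡ (eval-snoc y′ e₀ᵗ e₁ᵗ)) ⟩
    (E₀ᶠ + Y * E₁ᶠ) + y 0 * (E₀ᵗ + Y * E₁ᵗ)
      ≈⟨ solve 6 (λ y₀ Y a b c d → (a :+ Y :* c) :+ y₀ :* (b :+ Y :* d) := (a :+ y₀ :* b) :+ Y :* (c :+ y₀ :* d))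
           refl (y 0) Y E₀ᶠ E₀ᵗ E₁ᶠ E₁ᵗ ⟩
    (E₀ᶠ + y 0 * E₀ᵗ) + Y * (E₁ᶠ + y 0 * E₁ᵗ) ∎
    where
    y′ : ℕ → Carrier
    y′ k = y (suc k)
    ys : Vec Carrier (suc m)
    ys = tabulate (λ i → y′ (toℕ i))
    zs : Vec Carrier m
    zs = tabulate (λ i → y′ (toℕ i))
    Y = y (suc m)
    e₀ᶠ e₀ᵗ e₁ᶠ e₁ᵗ : Compliform m
    e₀ᶠ w = e₀ (false ∷ w)
    e₀ᵗ w = e₀ (true ∷ w)
    e₁ᶠ w = e₁ (false ∷ w)
    e₁ᵗ w = e₁ (true ∷ w)
    E₀ᶠ = eval e₀ᶠ zs; E₀ᵗ = eval e₀ᵗ zs; E₁ᶠ = eval e₁ᶠ zs; E₁ᵗ = eval e₁ᵗ zs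

  eval-toCompliform : ∀ {m} (y : ℕ → Carrier) (s : Multilinear m) →
                      eval (toCompliform s) (tabulate (λ i → y (toℕ i))) ≈ ⟦ s ⟧ y
  eval-toCompliform {zero}  y (p , q) = fromℤ-⊖ p q
  eval-toCompliform {suc m} y (u , v) =
    trans (eval-snoc y (toCompliform u) (toCompliform v))
          (+-cong (eval-toCompliform y u) (*-congˡ (eval-toCompliform y v)))

module Sums {c ℓ : Level} (R : CommutativeRing c ℓ) where
  open CommutativeRing R
  open Ops R using (sumTo; aHalf; TwoInvertible)
  open import Algebra.Solver.Ring.NaturalCoefficients.Default commutativeSemiring
    using (solve; _:+_; _:*_; _:=_)
  open import Relation.Binary.Reasoning.Setoid setoid

  sumTo-cong : ∀ n {f g : ℕ → Carrier} → (∀ k → k ≤ n → f k ≈ g k) → sumTo n f ≈ sumTo n g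
  sumTo-cong zero    f≈g = f≈g 0 z≤n
  sumTo-cong (suc n) f≈g =
    +-cong (sumTo-cong n (λ k k≤n → f≈g k (m≤n⇒m≤1+n k≤n))) (f≈g (suc n) ≤-refl)

  sumTo-suc : ∀ n (f : ℕ → Carrier) → sumTo (suc n) f ≈ f 0 + sumTo n (λ k → f (suc k))
  sumTo-suc zero    f = refl
  sumTo-suc (suc n) f = trans (+-congʳ (sumTo-suc n f)) (+-assoc _ _ _)

  aHalf-suc-suc : ∀ (f : ℕ → Carrier) n → aHalf f (suc (suc n)) ≡ aHalf (λ k → f (suc k)) n
  aHalf-suc-suc f n with half n
  ... | just k  = ≡.refl
  ... | nothing = ≡.refl

  sumTo-fold : ∀ n (f : ℕ → Carrier) → (∀ k → k ≤ n → f k ≈ f (n ∸ k)) →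
               sumTo n f + aHalf f n ≈ sumTo ⌊ n /2⌋ f + sumTo ⌊ n /2⌋ f
  sumTo-fold zero          f symmetric = refl
  sumTo-fold (suc zero)    f symmetric =
    trans (+-identityʳ _) (+-congˡ (symmetric 1 ≤-refl))
  sumTo-fold (suc (suc n)) f symmetric = begin
    sumTo (suc n) f + f (suc (suc n)) + aHalf f (suc (suc n))
      ≈⟨ +-cong (+-cong (sumTo-suc n f) last≈first) (reflexive (aHalf-suc-suc f n)) ⟩
    f 0 + S + f 0 + M                 ≈⟨ solve 3 (λ a S M → a :+ S :+ a :+ M := (a :+ a) :+ (S :+ M)) refl (f 0) S M ⟩
    (f 0 + f 0) + (S + M)             ≈⟨ +-congˡ (sumTo-fold n f′ symmetric′) ⟩
    (f 0 + f 0) + (T + T)             ≈⟨ solve 2 (λ a T → (a :+ a) :+ (T :+ T) := (a :+ T) :+ (a :+ T)) refl (f 0) T ⟩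
    (f 0 + T) + (f 0 + T)             ≈⟨ +-cong (sumTo-suc ⌊ n /2⌋ f) (sumTo-suc ⌊ n /2⌋ f) ⟨
    sumTo (suc ⌊ n /2⌋) f + sumTo (suc ⌊ n /2⌋) f ∎
    where
    f′ : ℕ → Carrier
    f′ k = f (suc k)
    S = sumTo n f′
    M = aHalf f′ n
    T = sumTo ⌊ n /2⌋ f′
    last≈first : f (suc (suc n)) ≈ f 0
    last≈first = trans (symmetric (suc (suc n)) ≤-refl) (reflexive (≡.cong f (n∸n≡0 n)))
    symmetric′ : ∀ k → k ≤ n → f′ k ≈ f′ (n ∸ k)
    symmetric′ k k≤n = trans (symmetric (suc k) (s≤s (m≤n⇒m≤1+n k≤n)))
                             (reflexive (≡.cong f (+-∸-assoc 1 k≤n)))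

  x+x≈y+y⇒x≈y : TwoInvertible → ∀ {x y} → x + x ≈ y + y → x ≈ y
  x+x≈y+y⇒x≈y (h , h*2≈1) {x} {y} x+x≈y+y = begin
    x                  ≈⟨ halve x ⟨
    h * (x + x)        ≈⟨ *-congˡ x+x≈y+y ⟩
    h * (y + y)        ≈⟨ halve y ⟩
    y                  ∎
    where
    halve : ∀ z → h * (z + z) ≈ z
    halve z = begin
      h * (z + z)              ≈⟨ *-congˡ (+-cong (*-identityˡ z) (*-identityˡ z)) ⟨
      h * (1# * z + 1# * z)    ≈⟨ *-congˡ (distribʳ z 1# 1#) ⟨
      h * ((1# + 1#) * z)      ≈⟨ *-assoc h (1# + 1#) z ⟨
      h * (1# + 1#) * z        ≈⟨ *-congʳ h*2≈1 ⟩
      1# * z                   ≈⟨ *-identityˡ z ⟩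
      z                        ∎

-- With xᵢ standing for a_{i+2}: aᴹ m k is a_k (for k ≤ m + 1), and pᴹ m is
-- Σ_{1 ≤ k ≤ n/2} a_k a_{n−k} for n = m + 2, so that c_n = a_n + pᴹ m in ETB.
aᴹ : (m k : ℕ) → Multilinear m
aᴹ m zero          = 1ᴹ m
aᴹ m (suc zero)    = 1ᴹ m
aᴹ m (suc (suc i)) = xᴹ m i

pᴹ : (m : ℕ) → Multilinear m
pᴹ m = sumᴹ ⌊ m /2⌋ (λ k → aᴹ m (suc k) *ᴹ aᴹ m (suc m ∸ k))

half≡just⇒≡+ : ∀ n {k} → half n ≡ just k → n ≡ k ℕ.+ k
half≡just⇒≡+ zero          ≡.refl = ≡.refl
half≡just⇒≡+ (suc (suc n)) eq with half n in eq′ | eq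
... | just j | ≡.refl = ≡.cong suc (≡.trans (≡.cong suc (half≡just⇒≡+ n eq′)) (≡.sym (+-suc j j)))

module ETB {ℓ₁ ℓ₂ : Level} (R : CommutativeRing ℓ₁ ℓ₂) (two : Ops.TwoInvertible R)
           (a b c : ℕ → CommutativeRing.Carrier R) (rel : Ops.ETBRelations R a b c) where
  open CommutativeRing R
  open Ops R using (sumTo; aHalf; eval)
  open Ops.ETBRelations rel
  open Evaluation R
  open Sums R
  open import Relation.Binary.Reasoning.Setoid setoid

  α γ : ℕ → Carrier
  α i = a (suc (suc i))
  γ i = c (suc (suc i))

  a-idempotent : ∀ k → a k * a k ≈ a k
  a-idempotent zero    = trans (*-cong a₀ a₀) (trans (*-identityˡ 1#) (sym a₀))
  a-idempotent (suc k) = a-idem (suc k) (s≤s z≤n)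

  α-idempotent : ∀ i → α i * α i ≈ α i
  α-idempotent i = a-idempotent (suc (suc i))

  aHalf≈aHalf-convolution : ∀ n → aHalf a n ≈ aHalf (λ k → a k * a (n ∸ k)) n
  aHalf≈aHalf-convolution n with half n in eq
  ... | just k  = sym (trans (*-congˡ (reflexive (≡.cong a n∸k≡k))) (a-idempotent k))
    where
    n∸k≡k : n ∸ k ≡ k
    n∸k≡k = ≡.trans (≡.cong (_∸ k) (half≡just⇒≡+ n eq)) (m+n∸n≡m k k)
  ... | nothing = refl

  c≈half-convolution : ∀ n → 1 ≤ n → c n ≈ sumTo ⌊ n /2⌋ (λ k → a k * a (n ∸ k))
  c≈half-convolution n 1≤n = x+x≈y+y⇒x≈y two (begin
    c n + c n                    ≈⟨ c-def n 1≤n ⟩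
    b n + aHalf a n              ≈⟨ +-cong (b-def n 1≤n) (aHalf≈aHalf-convolution n) ⟩
    sumTo n f + aHalf f n        ≈⟨ sumTo-fold n f symmetric ⟩
    sumTo ⌊ n /2⌋ f + sumTo ⌊ n /2⌋ f ∎)
    where
    f : ℕ → Carrier
    f k = a k * a (n ∸ k)
    symmetric : ∀ k → k ≤ n → f k ≈ f (n ∸ k)
    symmetric k k≤n = trans (*-comm (a k) (a (n ∸ k))) (*-congˡ (reflexive (≡.cong a (≡.sym (m∸[m∸n]≡n k≤n)))))

  aᴹ-correct : ∀ m k → k ≤ suc m → ⟦ aᴹ m k ⟧ α ≈ a k
  aᴹ-correct m zero          _    = trans (1ᴹ-homo m α) (sym a₀)
  aᴹ-correct m (suc zero)    _    = trans (1ᴹ-homo m α) (sym a₁)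
  aᴹ-correct m (suc (suc i)) k≤m+1 = xᴹ-homo α (≤-pred k≤m+1)

  pᴹ-correct : ∀ m → ⟦ pᴹ m ⟧ α ≈ sumTo ⌊ m /2⌋ (λ k → a (suc k) * a (suc m ∸ k))
  pᴹ-correct m = trans (sumᴹ-homo {m} ⌊ m /2⌋ _ α) (sumTo-cong ⌊ m /2⌋ λ k k≤m/2 →
    trans (*ᴹ-homo α α-idempotent (aᴹ m (suc k)) (aᴹ m (suc m ∸ k)))
          (*-cong (aᴹ-correct m (suc k) (s≤s (≤-trans k≤m/2 (⌊n/2⌋≤n m))))
                  (aᴹ-correct m (suc m ∸ k) (m∸n≤m (suc m) k))))

  γ≈α+pᴹ : ∀ m → γ m ≈ α m + ⟦ pᴹ m ⟧ α
  γ≈α+pᴹ m = begin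
    c (suc (suc m))                                         ≈⟨ c≈half-convolution (suc (suc m)) (s≤s z≤n) ⟩
    sumTo (suc ⌊ m /2⌋) (λ k → a k * a (suc (suc m) ∸ k))  ≈⟨ sumTo-suc ⌊ m /2⌋ _ ⟩
    a 0 * a (suc (suc m)) + sumTo ⌊ m /2⌋ (λ k → a (suc k) * a (suc m ∸ k))
      ≈⟨ +-cong (trans (*-congʳ a₀) (*-identityˡ _)) (sym (pᴹ-correct m)) ⟩
    α m + ⟦ pᴹ m ⟧ α                                        ∎

  γ≈α+compliform : ∀ m → γ m ≈ α m + eval (toCompliform (substitute pᴹ (pᴹ m))) (tabulate (λ i → γ (toℕ i)))
  γ≈α+compliform m = begin
    γ m                                          ≈⟨ γ≈α+pᴹ m ⟩
    α m + ⟦ pᴹ m ⟧ α                             ≈⟨ +-congˡ (substitute-correct pᴹ α γ α-idempotent γ≈α+pᴹ (pᴹ m)) ⟨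
    α m + ⟦ substitute pᴹ (pᴹ m) ⟧ γ             ≈⟨ +-congˡ (eval-toCompliform γ (substitute pᴹ (pᴹ m))) ⟨
    α m + eval (toCompliform (substitute pᴹ (pᴹ m))) (tabulate (λ i → γ (toℕ i))) ∎

open import Data.Nat using (_+_)

mainTheorem3 : (m : ℕ) → Σ (Compliform m) (λ e →
    (R : CommutativeRing 0ℓ 0ℓ) → Ops.TwoInvertible R →
    (a b c : ℕ → CommutativeRing.Carrier R) → Ops.ETBRelations R a b c →
    CommutativeRing._≈_ R (c (2 + m))
      (CommutativeRing._+_ R (a (2 + m)) (Ops.eval R e (tabulate (λ i → c (2 + toℕ i))))))
mainTheorem3 m = toCompliform (substitute pᴹ (pᴹ m)) ,
  λ R two a b c rel → ETB.γ≈α+compliform R two a b c rel m
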